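{- Let $C_{2n+1}$ ($n\ge1$) be a directed cycle of length $2n+1$ and $\mathcal{H}=\{G_v\}_{v\in V(C_{2n+1})}$ a family of $2n+1$ pairwise disjoint $c$-colored digraphs. Then the Zykov sum $C_{2n+1}[\mathcal{H}]$ does not have an up-color kernel.
   Context: A $c$-colored digraph has a function $c:V\to\{0,1,2,\ldots\}$. The Zykov sum $G[\mathcal{H}]$ of a connected digraph $G$ and a family $\{H_v\}_{v\in V(G)}$ of pairwise disjoint digraphs is obtained from $G$ by replacing each vertex $v$ by $H_v$ and adding an arc from every vertex of $H_u$ to every vertex of $H_v$ whenever $(u,v)\in A(G)$. A set $N$ of vertices is up-color absorbent if every vertex $x\notin N$ has an out-neighbor $y\in N$ with $c(x)<c(y)$, and no vertex of $N$ has color $0$; an up-color kernel is an independent up-color absorbent set. -}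

module Defs where

open import Data.Nat using (ℕ; zero; suc; _+_; _*_; _<_; NonZero)
open import Data.Nat.DivMod using (_%_)
open import Data.Fin using (Fin; toℕ)
open import Data.Product using (Σ; _×_; _,_)
open import Relation.Binary.PropositionalEquality using (_≡_; _≢_)
open import Relation.Nullary using (¬_)

record CDigraph : Set₁ where
  field
    nV       : ℕ
    nonempty : NonZero nV
    arc      : Fin nV → Fin nV → Set
    color    : Fin nV → ℕ
open CDigraph public

module _ {V : Set} (arcR : V → V → Set) (col : V → ℕ) where

  IsUpColorAbsorbent : (V → Set) → Set
  IsUpColorAbsorbent N =
    (∀ x → ¬ N x → Σ V λ y → N y × arcR x y × col x < col y)
    × (∀ x → N x → col x ≢ 0)

  IsIndependent : (V → Set) → Set
  IsIndependent N = ∀ x y → N x → N y → ¬ arcR x y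

  IsUpColorKernel : (V → Set) → Set
  IsUpColorKernel N = IsIndependent N × IsUpColorAbsorbent N

-- Zykov sum G[H] of a digraph G on Fin m (arc relation arcG) with a family
-- H of colored digraphs (disjointness is realised by the tagged sum).
module _ {m : ℕ} (arcG : Fin m → Fin m → Set) (H : Fin m → CDigraph) where

  ZykovV : Set
  ZykovV = Σ (Fin m) λ v → Fin (nV (H v))

  data ZykovArc : ZykovV → ZykovV → Set where
    inside  : ∀ {v x y} → arc (H v) x y → ZykovArc (v , x) (v , y)
    between : ∀ {u v x y} → arcG u v → ZykovArc (u , x) (v , y)

  zykovColor : ZykovV → ℕ
  zykovColor (v , x) = color (H v) x

CycleArc : (m : ℕ) → .{{NonZero m}} → Fin m → Fin m → Set
CycleArc m u v = toℕ v ≡ suc (toℕ u) % m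

{-# OPTIONS --safe #-}
module Submission where

-- Say that N occupies the vertex v of the cycle when N meets H_v. Independence of N
-- forbids two consecutive occupied vertices, while a vertex of an unoccupied H_v can
-- only be absorbed from H_{v+1}, so the successor of an unoccupied vertex is occupied.
-- Occupation therefore alternates around the cycle, which is impossible when its
-- length is odd.

open import Defs
open import Data.Nat using (ℕ; zero; suc; _+_; _*_; _≥_; NonZero; >-nonZero⁻¹)
open import Data.Nat.Properties using (*-suc)
open import Data.Nat.DivMod using (_%_; _mod_; m%n%n≡m%n; %-distribˡ-+; [m+n]%n≡m%n)
open import Data.Fin using (Fin; toℕ; fromℕ<)
open import Data.Fin.Properties using (toℕ-fromℕ<; toℕ-injective; fromℕ<-cong)
open import Data.Product using (Σ; ∃; _×_; _,_)
open import Data.Empty using (⊥; ⊥-elim)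
open import Relation.Nullary using (¬_)
open import Relation.Binary.PropositionalEquality using (_≡_; sym; trans; subst; cong; module ≡-Reasoning)

record IsKernel {V : Set} (arcR : V → V → Set) (N : V → Set) : Set where
  field
    independent : ∀ x y → N x → N y → ¬ arcR x y
    absorbent   : ∀ x → ¬ N x → Σ V λ y → N y × arcR x y

upColorKernel⇒kernel : {V : Set} {arcR : V → V → Set} {col : V → ℕ} {N : V → Set} →
  IsUpColorKernel arcR col N → IsKernel arcR N
upColorKernel⇒kernel (indep , absorb , _) = record
  { independent = indep
  ; absorbent   = λ x x∉N → let (y , y∈N , x→y , _) = absorb x x∉N in y , y∈N , x→y
  }

module _ {m : ℕ} {arcG : Fin m → Fin m → Set} {H : Fin m → CDigraph} where

  Occupies : (ZykovV arcG H → Set) → Fin m → Set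
  Occupies N v = ∃ λ x → N (v , x)

  zykovKernel⇒occupiedKernel : {N : ZykovV arcG H → Set} →
    IsKernel (ZykovArc arcG H) N → IsKernel arcG (Occupies N)
  zykovKernel⇒occupiedKernel {N} K = record
    { independent = λ u v (x , x∈N) (y , y∈N) u→v → independent (u , x) (v , y) x∈N y∈N (between u→v)
    ; absorbent   = absorbentG
    }
    where
    open IsKernel K

    someVertex : ∀ v → Fin (nV (H v))
    someVertex v = fromℕ< (>-nonZero⁻¹ (nV (H v)) {{nonempty (H v)}})

    absorbentG : ∀ u → ¬ Occupies N u → Σ (Fin m) λ w → Occupies N w × arcG u w
    absorbentG u u-free with absorbent (u , someVertex u) (λ x∈N → u-free (someVertex u , x∈N))
    ... | (_ , z) , z∈N , inside _    = ⊥-elim (u-free (z , z∈N))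
    ... | (w , z) , z∈N , between u→w = w , (z , z∈N) , u→w

module _ {P : ℕ → Set}
         (occupied⇒next-free : ∀ i → P i → ¬ P (suc i))
         (free⇒next-occupied : ∀ i → ¬ P i → P (suc i)) where

  alternating-even : ∀ j → (P 0 → P (2 * j)) × (¬ P 0 → ¬ P (2 * j))
  alternating-even zero    = (λ p → p) , (λ p → p)
  alternating-even (suc j) rewrite *-suc 2 j =
    let (same , ¬same) = alternating-even j in
      (λ p₀ → free⇒next-occupied _ (occupied⇒next-free _ (same p₀)))
    , (λ ¬p₀ → occupied⇒next-free _ (free⇒next-occupied _ (¬same ¬p₀)))

  alternating-oddPeriod-absurd : ∀ j → (P (suc (2 * j)) → P 0) → (P 0 → P (suc (2 * j))) → ⊥
  alternating-oddPeriod-absurd j Pm⇒P₀ P₀⇒Pm with alternating-even j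
  ... | same , ¬same = ¬p₀ (Pm⇒P₀ (free⇒next-occupied _ (¬same ¬p₀)))
    where
    ¬p₀ : ¬ P 0
    ¬p₀ p₀ = occupied⇒next-free _ (same p₀) (P₀⇒Pm p₀)

[1+m%n]%n≡[1+m]%n : ∀ m n .{{_ : NonZero n}} → suc (m % n) % n ≡ suc m % n
[1+m%n]%n≡[1+m]%n m n = begin
  (1 + m % n) % n          ≡⟨ %-distribˡ-+ 1 (m % n) n ⟩
  (1 % n + m % n % n) % n  ≡⟨ cong (λ r → (1 % n + r) % n) (m%n%n≡m%n m n) ⟩
  (1 % n + m % n) % n      ≡⟨ %-distribˡ-+ 1 m n ⟨
  (1 + m) % n              ∎
  where open ≡-Reasoning

module _ (m : ℕ) .{{_ : NonZero m}} where

  cycleArc-mod : ∀ i → CycleArc m (i mod m) (suc i mod m)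
  cycleArc-mod i = begin
    toℕ (suc i mod m)        ≡⟨ toℕ-fromℕ< _ ⟩
    suc i % m                ≡⟨ [1+m%n]%n≡[1+m]%n i m ⟨
    suc (i % m) % m          ≡⟨ cong (λ r → suc r % m) (toℕ-fromℕ< _) ⟨
    suc (toℕ (i mod m)) % m  ∎
    where open ≡-Reasoning

  cycleArc-unique : ∀ {u v w} → CycleArc m u v → CycleArc m u w → v ≡ w
  cycleArc-unique u→v u→w = toℕ-injective (trans u→v (sym u→w))

  m-mod-m≡0-mod-m : m mod m ≡ 0 mod m
  m-mod-m≡0-mod-m = fromℕ<-cong _ _ ([m+n]%n≡m%n 0 m) _ _

  module _ {N : Fin m → Set} (K : IsKernel (CycleArc m) N) where
    open IsKernel K

    cycleKernel-occupied⇒next-free : ∀ i → N (i mod m) → ¬ N (suc i mod m)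
    cycleKernel-occupied⇒next-free i i∈N i+1∈N = independent _ _ i∈N i+1∈N (cycleArc-mod i)

    cycleKernel-free⇒next-occupied : ∀ i → ¬ N (i mod m) → N (suc i mod m)
    cycleKernel-free⇒next-occupied i i∉N with absorbent (i mod m) i∉N
    ... | w , w∈N , i→w = subst N (cycleArc-unique i→w (cycleArc-mod i)) w∈N

oddCycle-noKernel : ∀ n {N : Fin (suc (2 * n)) → Set} → ¬ IsKernel (CycleArc (suc (2 * n))) N
oddCycle-noKernel n {N} K =
  alternating-oddPeriod-absurd
    (cycleKernel-occupied⇒next-free m K) (cycleKernel-free⇒next-occupied m K) n
    (subst N (m-mod-m≡0-mod-m m)) (subst N (sym (m-mod-m≡0-mod-m m)))
  where
  m : ℕ
  m = suc (2 * n)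

mainTheorem15 : (n : ℕ) → n ≥ 1 → (H : Fin (suc (2 * n)) → CDigraph) →
    ¬ (Σ (ZykovV (CycleArc (suc (2 * n))) H → Set) λ N →
    IsUpColorKernel (ZykovArc (CycleArc (suc (2 * n))) H) (zykovColor (CycleArc (suc (2 * n))) H) N)
mainTheorem15 n _ _ (_ , K) =
  oddCycle-noKernel n (zykovKernel⇒occupiedKernel (upColorKernel⇒kernel K))
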